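{- Let $U:\mathcal{E}\to\mathcal{B}$ be a Lawvere category and $U':\mathcal{E}'\to\mathcal{B}$ be a fibration. Then the pullback $U'^*U:U'^*\mathcal{E}\to\mathcal{E}'$ of $U$ along $U'$ is a Lawvere category.
   Context: A CCU is a fibration $U:\mathcal{E}\to\mathcal{B}$ with fibred terminal objects (each fibre has a terminal object, preserved by reindexing) whose truth functor $K:\mathcal{B}\to\mathcal{E}$ (sending $X$ to the terminal object of $\mathcal{E}_X$) has a right adjoint. A Lawvere category is a CCU that is also a bifibration (i.e. also an opfibration). The pullback $U'^*\mathcal{E}$ has objects pairs $(P',P)$ with $U'P'=UP$, and $U'^*U(P',P)=P'$. -}

module Defs where

open import Level using (Level; _⊔_) renaming (suc to lsuc)
open import Data.Product using (Σ; _×_; _,_; proj₁; proj₂)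
open import Relation.Binary using (IsEquivalence; Setoid)
open import Relation.Binary.PropositionalEquality using (_≡_; refl; sym; trans; subst)
import Relation.Binary.Reasoning.Setoid as SetoidR

record Category (o ℓ e : Level) : Set (lsuc (o ⊔ ℓ ⊔ e)) where
  infixr 9 _∘_
  infix  4 _≈_
  field
    Obj       : Set o
    _⇒_       : Obj → Obj → Set ℓ
    _≈_       : ∀ {A B} → A ⇒ B → A ⇒ B → Set e
    id        : ∀ {A} → A ⇒ A
    _∘_       : ∀ {A B C} → B ⇒ C → A ⇒ B → A ⇒ C
    equiv     : ∀ {A B} → IsEquivalence (_≈_ {A} {B})
    assoc     : ∀ {A B C D} {f : A ⇒ B} {g : B ⇒ C} {h : C ⇒ D} →
                (h ∘ g) ∘ f ≈ h ∘ (g ∘ f)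
    identityˡ : ∀ {A B} {f : A ⇒ B} → id ∘ f ≈ f
    identityʳ : ∀ {A B} {f : A ⇒ B} → f ∘ id ≈ f
    ∘-resp-≈  : ∀ {A B C} {f h : B ⇒ C} {g i : A ⇒ B} →
                f ≈ h → g ≈ i → f ∘ g ≈ h ∘ i

  hom-setoid : Obj → Obj → Setoid ℓ e
  hom-setoid A B = record { Carrier = A ⇒ B ; _≈_ = _≈_ ; isEquivalence = equiv }

  module Equiv {A B : Obj} = IsEquivalence (equiv {A} {B})

  cast : ∀ {A B} → A ≡ B → A ⇒ B
  cast {A} e = subst (λ Z → A ⇒ Z) e id

  ∃!⇒ : ∀ {p} {A B} → (A ⇒ B → Set p) → Set (ℓ ⊔ e ⊔ p)
  ∃!⇒ {A = A} {B} P = Σ (A ⇒ B) λ h → P h × (∀ h' → P h' → h' ≈ h)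

record Functor {o ℓ e o′ ℓ′ e′} (C : Category o ℓ e) (D : Category o′ ℓ′ e′)
       : Set (o ⊔ ℓ ⊔ e ⊔ o′ ⊔ ℓ′ ⊔ e′) where
  private
    module C = Category C
    module D = Category D
  field
    F₀           : C.Obj → D.Obj
    F₁           : ∀ {A B} → A C.⇒ B → F₀ A D.⇒ F₀ B
    identity     : ∀ {A} → F₁ (C.id {A}) D.≈ D.id
    homomorphism : ∀ {A B C} {f : A C.⇒ B} {g : B C.⇒ C} →
                   F₁ (g C.∘ f) D.≈ F₁ g D.∘ F₁ f
    F-resp-≈     : ∀ {A B} {f g : A C.⇒ B} → f C.≈ g → F₁ f D.≈ F₁ g

record Adjunction {o ℓ e o′ ℓ′ e′} {C : Category o ℓ e} {D : Category o′ ℓ′ e′}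
       (L : Functor C D) (R : Functor D C) : Set (o ⊔ ℓ ⊔ e ⊔ o′ ⊔ ℓ′ ⊔ e′) where
  private
    module C = Category C
    module D = Category D
    module L = Functor L
    module R = Functor R
  field
    unit      : ∀ X → X C.⇒ R.F₀ (L.F₀ X)
    counit    : ∀ A → L.F₀ (R.F₀ A) D.⇒ A
    unit-nat  : ∀ {X Y} (f : X C.⇒ Y) →
                R.F₁ (L.F₁ f) C.∘ unit X C.≈ unit Y C.∘ f
    counit-nat : ∀ {A B} (g : A D.⇒ B) →
                g D.∘ counit A D.≈ counit B D.∘ L.F₁ (R.F₁ g)
    zig       : ∀ X → counit (L.F₀ X) D.∘ L.F₁ (unit X) D.≈ D.id
    zag       : ∀ A → R.F₁ (counit A) C.∘ unit (R.F₀ A) C.≈ C.id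

HasRightAdjoint : ∀ {o ℓ e o′ ℓ′ e′} {C : Category o ℓ e} {D : Category o′ ℓ′ e′} →
                  Functor C D → Set (o ⊔ ℓ ⊔ e ⊔ o′ ⊔ ℓ′ ⊔ e′)
HasRightAdjoint {C = C} {D} F = Σ (Functor D C) λ G → Adjunction F G

module _ {o ℓ e ob ℓb eb} {E : Category o ℓ e} {B : Category ob ℓb eb}
         (U : Functor E B) where
  private
    module E = Category E
    module B = Category B
    module U = Functor U

  IsCartesian : ∀ {Q P} → Q E.⇒ P → Set (o ⊔ ℓ ⊔ e ⊔ ℓb ⊔ eb)
  IsCartesian {Q} {P} φ =
    ∀ {R} (ψ : R E.⇒ P) (g : U.F₀ R B.⇒ U.F₀ Q) → U.F₁ φ B.∘ g B.≈ U.F₁ ψ →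
    E.∃!⇒ {A = R} {B = Q} (λ χ → (U.F₁ χ B.≈ g) × (φ E.∘ χ E.≈ ψ))

  IsOpcartesian : ∀ {P Q} → P E.⇒ Q → Set (o ⊔ ℓ ⊔ e ⊔ ℓb ⊔ eb)
  IsOpcartesian {P} {Q} φ =
    ∀ {R} (ψ : P E.⇒ R) (g : U.F₀ Q B.⇒ U.F₀ R) → g B.∘ U.F₁ φ B.≈ U.F₁ ψ →
    E.∃!⇒ {A = Q} {B = R} (λ χ → (U.F₁ χ B.≈ g) × (χ E.∘ φ E.≈ ψ))

  IsFibration : Set (o ⊔ ℓ ⊔ e ⊔ ob ⊔ ℓb ⊔ eb)
  IsFibration =
    ∀ {A} (P : E.Obj) (f : A B.⇒ U.F₀ P) →
    Σ E.Obj λ Q → Σ (U.F₀ Q ≡ A) λ eq → Σ (Q E.⇒ P) λ φ →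
      IsCartesian φ × (U.F₁ φ B.≈ f B.∘ B.cast eq)

  IsOpfibration : Set (o ⊔ ℓ ⊔ e ⊔ ob ⊔ ℓb ⊔ eb)
  IsOpfibration =
    ∀ {A} (P : E.Obj) (f : U.F₀ P B.⇒ A) →
    Σ E.Obj λ Q → Σ (U.F₀ Q ≡ A) λ eq → Σ (P E.⇒ Q) λ φ →
      IsOpcartesian φ × (B.cast eq B.∘ U.F₁ φ B.≈ f)

  IsBifibration : Set (o ⊔ ℓ ⊔ e ⊔ ob ⊔ ℓb ⊔ eb)
  IsBifibration = IsFibration × IsOpfibration

  IsFibreTerminal : E.Obj → Set (o ⊔ ℓ ⊔ e ⊔ ob ⊔ eb)
  IsFibreTerminal P =
    ∀ R (eq : U.F₀ R ≡ U.F₀ P) →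
    E.∃!⇒ {A = R} {B = P} (λ h → U.F₁ h B.≈ B.cast eq)

  -- A CCU: a fibration with fibred terminal objects (each fibre has a terminal
  -- object, and reindexing (cartesian lifting) preserves fibre-terminal objects),
  -- whose truth functor K (X ↦ terminal object of E_X, f ↦ the morphism over f)
  -- has a right adjoint.
  record IsCCU : Set (o ⊔ ℓ ⊔ e ⊔ ob ⊔ ℓb ⊔ eb) where
    field
      fibration     : IsFibration
      K             : Functor B E
    private module K = Functor K
    field
      K-over        : ∀ X → U.F₀ (K.F₀ X) ≡ X
      K-terminal    : ∀ X → IsFibreTerminal (K.F₀ X)
      K-over-mor    : ∀ {X Y} (f : X B.⇒ Y) →
                      U.F₁ (K.F₁ f) B.≈ B.cast (sym (K-over Y)) B.∘ (f B.∘ B.cast (K-over X))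
      reindex-terminal : ∀ {Q P} (φ : Q E.⇒ P) → IsCartesian φ →
                         IsFibreTerminal P → IsFibreTerminal Q
      K-rightAdjoint : HasRightAdjoint K

  IsLawvere : Set (o ⊔ ℓ ⊔ e ⊔ ob ⊔ ℓb ⊔ eb)
  IsLawvere = IsCCU × IsOpfibration

module _ {o ℓ e ob ℓb eb o′ ℓ′ e′}
         {E : Category o ℓ e} {B : Category ob ℓb eb} {E′ : Category o′ ℓ′ e′}
         (U : Functor E B) (U′ : Functor E′ B) where
  private
    module E = Category E
    module B = Category B
    module E′ = Category E′
    module U = Functor U
    module U′ = Functor U′

  PbObj : Set (o ⊔ ob ⊔ o′)
  PbObj = Σ E′.Obj λ P′ → Σ E.Obj λ P → U′.F₀ P′ ≡ U.F₀ P

  record PbHom (X Y : PbObj) : Set (ℓ ⊔ ℓ′ ⊔ eb) where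
    constructor pbhom
    field
      hom′ : proj₁ X E′.⇒ proj₁ Y
      hom  : proj₁ (proj₂ X) E.⇒ proj₁ (proj₂ Y)
      comm : B.cast (proj₂ (proj₂ Y)) B.∘ U′.F₁ hom′
             B.≈ U.F₁ hom B.∘ B.cast (proj₂ (proj₂ X))

  open PbHom

  private
    pb-id : ∀ {X} → PbHom X X
    pb-id {X} = pbhom E′.id E.id (begin
        B.cast c B.∘ U′.F₁ E′.id ≈⟨ B.∘-resp-≈ B.Equiv.refl U′.identity ⟩
        B.cast c B.∘ B.id        ≈⟨ B.identityʳ ⟩
        B.cast c                 ≈⟨ B.Equiv.sym B.identityˡ ⟩
        B.id B.∘ B.cast c        ≈⟨ B.∘-resp-≈ (B.Equiv.sym U.identity) B.Equiv.refl ⟩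
        U.F₁ E.id B.∘ B.cast c   ∎)
      where
        c = proj₂ (proj₂ X)
        open SetoidR (B.hom-setoid _ _)

    pb-∘ : ∀ {X Y Z} → PbHom Y Z → PbHom X Y → PbHom X Z
    pb-∘ {X} {Y} {Z} (pbhom g′ g cg) (pbhom f′ f cf) = pbhom (g′ E′.∘ f′) (g E.∘ f) (begin
        B.cast cz B.∘ U′.F₁ (g′ E′.∘ f′)
          ≈⟨ B.∘-resp-≈ B.Equiv.refl U′.homomorphism ⟩
        B.cast cz B.∘ (U′.F₁ g′ B.∘ U′.F₁ f′)
          ≈⟨ B.Equiv.sym B.assoc ⟩
        (B.cast cz B.∘ U′.F₁ g′) B.∘ U′.F₁ f′
          ≈⟨ B.∘-resp-≈ cg B.Equiv.refl ⟩
        (U.F₁ g B.∘ B.cast cy) B.∘ U′.F₁ f′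
          ≈⟨ B.assoc ⟩
        U.F₁ g B.∘ (B.cast cy B.∘ U′.F₁ f′)
          ≈⟨ B.∘-resp-≈ B.Equiv.refl cf ⟩
        U.F₁ g B.∘ (U.F₁ f B.∘ B.cast cx)
          ≈⟨ B.Equiv.sym B.assoc ⟩
        (U.F₁ g B.∘ U.F₁ f) B.∘ B.cast cx
          ≈⟨ B.∘-resp-≈ (B.Equiv.sym U.homomorphism) B.Equiv.refl ⟩
        U.F₁ (g E.∘ f) B.∘ B.cast cx ∎)
      where
        cx = proj₂ (proj₂ X)
        cy = proj₂ (proj₂ Y)
        cz = proj₂ (proj₂ Z)
        open SetoidR (B.hom-setoid _ _)

  PullbackCat : Category (o ⊔ ob ⊔ o′) (ℓ ⊔ ℓ′ ⊔ eb) (e ⊔ e′)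
  PullbackCat = record
    { Obj       = PbObj
    ; _⇒_       = PbHom
    ; _≈_       = λ f g → (hom′ f E′.≈ hom′ g) × (hom f E.≈ hom g)
    ; id        = pb-id
    ; _∘_       = pb-∘
    ; equiv     = record
        { refl  = E′.Equiv.refl , E.Equiv.refl
        ; sym   = λ p → E′.Equiv.sym (proj₁ p) , E.Equiv.sym (proj₂ p)
        ; trans = λ p q → E′.Equiv.trans (proj₁ p) (proj₁ q) , E.Equiv.trans (proj₂ p) (proj₂ q)
        }
    ; assoc     = E′.assoc , E.assoc
    ; identityˡ = E′.identityˡ , E.identityˡ
    ; identityʳ = E′.identityʳ , E.identityʳ
    ; ∘-resp-≈  = λ p q → E′.∘-resp-≈ (proj₁ p) (proj₁ q) , E.∘-resp-≈ (proj₂ p) (proj₂ q)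
    }

  PullbackFunctor : Functor PullbackCat E′
  PullbackFunctor = record
    { F₀           = proj₁
    ; F₁           = hom′
    ; identity     = E′.Equiv.refl
    ; homomorphism = E′.Equiv.refl
    ; F-resp-≈     = proj₁
    }

-- Everything in U′*E is computed componentwise.  A morphism (f′ , f) is (op)cartesian as soon
-- as f is, so (op)cartesian lifts are obtained by lifting in E; an object (P′ , P) is
-- fibre-terminal exactly when P is; and the truth functor sends X′ to (X′ , K (U′ X′)).  If
-- K ⊣ G, the right adjoint of the new truth functor sends (P′ , P) to the domain of a cartesian
-- lift along U′ of the image of the counit K (G P) ⇒ P: its universal property combines the
-- cartesian property of that lift with the adjunction K ⊣ G.
module Submission where

open import Defs
open import Data.Product using (Σ; _×_; _,_; proj₁; proj₂)
import Relation.Binary.PropositionalEquality as ≡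
open ≡ using (_≡_; refl)
open import Level using (_⊔_)

module HomReasoning {o ℓ e} (C : Category o ℓ e) where
  open Category C
  open Equiv public renaming (refl to ≈-refl; sym to ≈-sym; trans to ≈-trans)

  infixr 4 _⟩∘⟨_
  infixr 2 _≈⟨_⟩_
  infix  3 _∎
  infix  1 begin_

  _⟩∘⟨_ : ∀ {A B D} {f h : B ⇒ D} {g i : A ⇒ B} → f ≈ h → g ≈ i → f ∘ g ≈ h ∘ i
  _⟩∘⟨_ = ∘-resp-≈

  refl⟩∘⟨_ : ∀ {A B D} {f : B ⇒ D} {g i : A ⇒ B} → g ≈ i → f ∘ g ≈ f ∘ i
  refl⟩∘⟨ p = ∘-resp-≈ ≈-refl p

  _⟩∘⟨refl : ∀ {A B D} {f h : B ⇒ D} {g : A ⇒ B} → f ≈ h → f ∘ g ≈ h ∘ g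
  p ⟩∘⟨refl = ∘-resp-≈ p ≈-refl

  begin_ : ∀ {A B} {f g : A ⇒ B} → f ≈ g → f ≈ g
  begin p = p

  _≈⟨_⟩_ : ∀ {A B} (f : A ⇒ B) {g h : A ⇒ B} → f ≈ g → g ≈ h → f ≈ h
  f ≈⟨ p ⟩ q = ≈-trans p q

  _∎ : ∀ {A B} (f : A ⇒ B) → f ≈ f
  f ∎ = ≈-refl

  cancelˡ : ∀ {A B D} {g : B ⇒ D} {f : D ⇒ B} {h : A ⇒ B} → f ∘ g ≈ id → f ∘ (g ∘ h) ≈ h
  cancelˡ p = ≈-trans (≈-sym assoc) (≈-trans (p ⟩∘⟨refl) identityˡ)

  cancelʳ : ∀ {B D F} {g : B ⇒ D} {f : D ⇒ B} {h : B ⇒ F} → f ∘ g ≈ id → (h ∘ f) ∘ g ≈ h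
  cancelʳ p = ≈-trans assoc (≈-trans (refl⟩∘⟨ p) identityʳ)

  cancelInner : ∀ {A B D F} {g : B ⇒ D} {f : D ⇒ B} {h : D ⇒ F} {k : A ⇒ D} →
                g ∘ f ≈ id → (h ∘ g) ∘ (f ∘ k) ≈ h ∘ k
  cancelInner p = ≈-trans assoc (refl⟩∘⟨ cancelˡ p)

  cast-trans : ∀ {A B D} (p : A ≡ B) (q : B ≡ D) → cast (≡.trans p q) ≈ cast q ∘ cast p
  cast-trans refl refl = ≈-sym identityˡ

  cast-symˡ : ∀ {A B} (p : A ≡ B) → cast (≡.sym p) ∘ cast p ≈ id
  cast-symˡ refl = identityˡ

  cast-symʳ : ∀ {A B} (p : A ≡ B) → cast p ∘ cast (≡.sym p) ≈ id
  cast-symʳ refl = identityˡ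

  cast-sym-sym : ∀ {A B} (p : A ≡ B) → cast (≡.sym (≡.sym p)) ≈ cast p
  cast-sym-sym refl = ≈-refl

  cast-trans-sym-trans : ∀ {A B D} (p : A ≡ B) (q : D ≡ B) →
                         cast (≡.trans (≡.sym (≡.trans p (≡.sym q))) p) ≈ cast q
  cast-trans-sym-trans refl refl = ≈-refl

  transposeʳ : ∀ {A B D} {f : B ⇒ D} {k : A ⇒ D} (p : A ≡ B) →
               f ∘ cast p ≈ k → f ≈ k ∘ cast (≡.sym p)
  transposeʳ p q = ≈-trans (≈-sym (cancelʳ (cast-symʳ p))) (q ⟩∘⟨refl)

  transposeˡ : ∀ {A B D} {a : D ⇒ A} {k : D ⇒ B} (p : A ≡ B) →
               cast p ∘ a ≈ k → a ≈ cast (≡.sym p) ∘ k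
  transposeˡ p q = ≈-trans (≈-sym (cancelˡ (cast-symˡ p))) (refl⟩∘⟨ q)

module _ {o ℓ e o′ ℓ′ e′} {C : Category o ℓ e} {D : Category o′ ℓ′ e′}
         {L : Functor C D} {R : Functor D C} (adj : Adjunction L R) where
  private
    module C = Category C
    module D = Category D
    module L = Functor L
    module R = Functor R
    module CR = HomReasoning C
  open HomReasoning D
  open Adjunction adj

  counit-universal : ∀ {X A} (f : L.F₀ X D.⇒ A) →
                     C.∃!⇒ {A = X} {B = R.F₀ A} (λ g → counit A D.∘ L.F₁ g D.≈ f)
  counit-universal {X} {A} f = R.F₁ f C.∘ unit X , factors , unique
    where
    factors : counit A D.∘ L.F₁ (R.F₁ f C.∘ unit X) D.≈ f
    factors = begin
      counit A D.∘ L.F₁ (R.F₁ f C.∘ unit X)          ≈⟨ refl⟩∘⟨ L.homomorphism ⟩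
      counit A D.∘ (L.F₁ (R.F₁ f) D.∘ L.F₁ (unit X)) ≈⟨ ≈-sym D.assoc ⟩
      (counit A D.∘ L.F₁ (R.F₁ f)) D.∘ L.F₁ (unit X) ≈⟨ ≈-sym (counit-nat f) ⟩∘⟨refl ⟩
      (f D.∘ counit (L.F₀ X)) D.∘ L.F₁ (unit X)      ≈⟨ D.assoc ⟩
      f D.∘ (counit (L.F₀ X) D.∘ L.F₁ (unit X))      ≈⟨ refl⟩∘⟨ zig X ⟩
      f D.∘ D.id                                     ≈⟨ D.identityʳ ⟩
      f                                              ∎
    unique : ∀ g → counit A D.∘ L.F₁ g D.≈ f → g C.≈ R.F₁ f C.∘ unit X
    unique g p = CR.≈-sym (CR.begin
      R.F₁ f C.∘ unit X                              CR.≈⟨ R.F-resp-≈ (≈-sym p) CR.⟩∘⟨refl ⟩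
      R.F₁ (counit A D.∘ L.F₁ g) C.∘ unit X          CR.≈⟨ R.homomorphism CR.⟩∘⟨refl ⟩
      (R.F₁ (counit A) C.∘ R.F₁ (L.F₁ g)) C.∘ unit X CR.≈⟨ C.assoc ⟩
      R.F₁ (counit A) C.∘ (R.F₁ (L.F₁ g) C.∘ unit X) CR.≈⟨ CR.refl⟩∘⟨ unit-nat g ⟩
      R.F₁ (counit A) C.∘ (unit (R.F₀ A) C.∘ g)      CR.≈⟨ CR.≈-sym C.assoc ⟩
      (R.F₁ (counit A) C.∘ unit (R.F₀ A)) C.∘ g      CR.≈⟨ zag A CR.⟩∘⟨refl ⟩
      C.id C.∘ g                                     CR.≈⟨ C.identityˡ ⟩
      g                                              CR.∎)

module RightAdjointFromCounit
    {o ℓ e o′ ℓ′ e′} {C : Category o ℓ e} {D : Category o′ ℓ′ e′}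
    (L : Functor C D)
    (R₀ : Category.Obj D → Category.Obj C)
    (ε : ∀ A → Category._⇒_ D (Functor.F₀ L (R₀ A)) A)
    (universal : ∀ {X A} (f : Category._⇒_ D (Functor.F₀ L X) A) →
                 Category.∃!⇒ C {A = X} {B = R₀ A}
                   (λ g → Category._≈_ D (Category._∘_ D (ε A) (Functor.F₁ L g)) f))
    where
  private
    module C = Category C
    module D = Category D
    module L = Functor L
    module CR = HomReasoning C
  open HomReasoning D

  factor : ∀ {X A} → L.F₀ X D.⇒ A → X C.⇒ R₀ A
  factor f = proj₁ (universal f)

  factor-unique : ∀ {X A} {f : L.F₀ X D.⇒ A} {g₁ g₂ : X C.⇒ R₀ A} →
                  ε A D.∘ L.F₁ g₁ D.≈ f → ε A D.∘ L.F₁ g₂ D.≈ f → g₁ C.≈ g₂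
  factor-unique {f = f} p q =
    CR.≈-trans (proj₂ (proj₂ (universal f)) _ p) (CR.≈-sym (proj₂ (proj₂ (universal f)) _ q))

  ε∘L-∘ : ∀ {X Y A} (h : Y C.⇒ R₀ A) (k : X C.⇒ Y) {a : L.F₀ Y D.⇒ A} →
          ε A D.∘ L.F₁ h D.≈ a → ε A D.∘ L.F₁ (h C.∘ k) D.≈ a D.∘ L.F₁ k
  ε∘L-∘ {A = A} h k {a} p = begin
    ε A D.∘ L.F₁ (h C.∘ k)         ≈⟨ refl⟩∘⟨ L.homomorphism ⟩
    ε A D.∘ (L.F₁ h D.∘ L.F₁ k)    ≈⟨ ≈-sym D.assoc ⟩
    (ε A D.∘ L.F₁ h) D.∘ L.F₁ k    ≈⟨ p ⟩∘⟨refl ⟩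
    a D.∘ L.F₁ k                   ∎

  R₁ : ∀ {A B} → A D.⇒ B → R₀ A C.⇒ R₀ B
  R₁ {A} g = factor (g D.∘ ε A)

  R₁-factors : ∀ {A B} (g : A D.⇒ B) → ε B D.∘ L.F₁ (R₁ g) D.≈ g D.∘ ε A
  R₁-factors {A} g = proj₁ (proj₂ (universal (g D.∘ ε A)))

  η : ∀ X → X C.⇒ R₀ (L.F₀ X)
  η X = factor (D.id {L.F₀ X})

  η-factors : ∀ X → ε (L.F₀ X) D.∘ L.F₁ (η X) D.≈ D.id
  η-factors X = proj₁ (proj₂ (universal (D.id {L.F₀ X})))

  ∘ε∘Lη : ∀ {X A} (a : L.F₀ X D.⇒ A) → (a D.∘ ε (L.F₀ X)) D.∘ L.F₁ (η X) D.≈ a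
  ∘ε∘Lη {X} a = ≈-trans D.assoc (≈-trans (refl⟩∘⟨ η-factors X) D.identityʳ)

  ε∘L-id : ∀ {A} → ε A D.∘ L.F₁ C.id D.≈ ε A
  ε∘L-id = ≈-trans (refl⟩∘⟨ L.identity) D.identityʳ

  R : Functor D C
  R = record
    { F₀           = R₀
    ; F₁           = R₁
    ; identity     = factor-unique (R₁-factors D.id) (≈-trans ε∘L-id (≈-sym D.identityˡ))
    ; homomorphism = λ {A} {B} {Z} {f} {g} → factor-unique (R₁-factors (g D.∘ f)) (begin
        ε Z D.∘ L.F₁ (R₁ g C.∘ R₁ f)  ≈⟨ ε∘L-∘ (R₁ g) (R₁ f) (R₁-factors g) ⟩
        (g D.∘ ε B) D.∘ L.F₁ (R₁ f)   ≈⟨ D.assoc ⟩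
        g D.∘ (ε B D.∘ L.F₁ (R₁ f))   ≈⟨ refl⟩∘⟨ R₁-factors f ⟩
        g D.∘ (f D.∘ ε A)             ≈⟨ ≈-sym D.assoc ⟩
        (g D.∘ f) D.∘ ε A             ∎)
    ; F-resp-≈     = λ {_} {_} {f} {g} p →
        factor-unique (R₁-factors f) (≈-trans (R₁-factors g) (≈-sym p ⟩∘⟨refl))
    }

  adjunction : Adjunction L R
  adjunction = record
    { unit       = η
    ; counit     = ε
    ; unit-nat   = λ {X} {Y} f → factor-unique
        (≈-trans (ε∘L-∘ (R₁ (L.F₁ f)) (η X) (R₁-factors (L.F₁ f))) (∘ε∘Lη (L.F₁ f)))
        (≈-trans (ε∘L-∘ (η Y) f (η-factors Y)) D.identityˡ)
    ; counit-nat = λ g → ≈-sym (R₁-factors g)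
    ; zig        = η-factors
    ; zag        = λ A → factor-unique
        (≈-trans (ε∘L-∘ (R₁ (ε A)) (η (R₀ A)) (R₁-factors (ε A))) (∘ε∘Lη (ε A)))
        ε∘L-id
    }

  rightAdjoint : HasRightAdjoint L
  rightAdjoint = R , adjunction

module PullbackProperties
    {o ℓ e ob ℓb eb o′ ℓ′ e′}
    {B : Category ob ℓb eb} {E : Category o ℓ e} {E′ : Category o′ ℓ′ e′}
    (U : Functor E B) (U′ : Functor E′ B) where
  private
    module B = Category B
    module E = Category E
    module E′ = Category E′
    module U = Functor U
    module U′ = Functor U′
    module E′R = HomReasoning E′
  open HomReasoning B

  Pb : Category (o ⊔ ob ⊔ o′) (ℓ ⊔ ℓ′ ⊔ eb) (e ⊔ e′)
  Pb = PullbackCat U U′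

  π : Functor Pb E′
  π = PullbackFunctor U U′

  private
    module Pb = Category Pb
  open PbHom public

  conj : (X Y : Pb.Obj) → U′.F₀ (proj₁ X) B.⇒ U′.F₀ (proj₁ Y) →
         U.F₀ (proj₁ (proj₂ X)) B.⇒ U.F₀ (proj₁ (proj₂ Y))
  conj (_ , _ , cX) (_ , _ , cY) u = B.cast cY B.∘ (u B.∘ B.cast (≡.sym cX))

  conj-resp-≈ : ∀ (X Y : Pb.Obj) {u v} → u B.≈ v → conj X Y u B.≈ conj X Y v
  conj-resp-≈ _ _ p = refl⟩∘⟨ (p ⟩∘⟨refl)

  conj-∘ : ∀ (X Y Z : Pb.Obj) {u v} → conj Y Z v B.∘ conj X Y u B.≈ conj X Z (v B.∘ u)
  conj-∘ (_ , _ , cX) (_ , _ , cY) (_ , _ , cZ) {u} {v} = begin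
    (B.cast cZ B.∘ (v B.∘ B.cast (≡.sym cY))) B.∘ (B.cast cY B.∘ (u B.∘ B.cast (≡.sym cX)))
      ≈⟨ ≈-trans B.assoc (refl⟩∘⟨ cancelInner (cast-symˡ cY)) ⟩
    B.cast cZ B.∘ (v B.∘ (u B.∘ B.cast (≡.sym cX)))
      ≈⟨ refl⟩∘⟨ ≈-sym B.assoc ⟩
    B.cast cZ B.∘ ((v B.∘ u) B.∘ B.cast (≡.sym cX)) ∎

  conj-injective : ∀ (X Y : Pb.Obj) {u v} → conj X Y u B.≈ conj X Y v → u B.≈ v
  conj-injective X@(_ , _ , cX) Y@(_ , _ , cY) {u} {v} p =
    ≈-trans (≈-sym (uncast u)) (≈-trans ((refl⟩∘⟨ p) ⟩∘⟨refl) (uncast v))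
    where
    uncast : ∀ w → (B.cast (≡.sym cY) B.∘ conj X Y w) B.∘ B.cast cX B.≈ w
    uncast w = ≈-trans (cancelˡ (cast-symˡ cY) ⟩∘⟨refl) (cancelʳ (cast-symˡ cX))

  base : (X Y : Pb.Obj) → proj₁ X E′.⇒ proj₁ Y → U.F₀ (proj₁ (proj₂ X)) B.⇒ U.F₀ (proj₁ (proj₂ Y))
  base X Y f′ = conj X Y (U′.F₁ f′)

  base-resp-≈ : ∀ (X Y : Pb.Obj) {f′ g′} → f′ E′.≈ g′ → base X Y f′ B.≈ base X Y g′
  base-resp-≈ X Y p = conj-resp-≈ X Y (U′.F-resp-≈ p)

  base-∘ : ∀ (X Y Z : Pb.Obj) {f′ g′} → base Y Z g′ B.∘ base X Y f′ B.≈ base X Z (g′ E′.∘ f′)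
  base-∘ X Y Z = ≈-trans (conj-∘ X Y Z) (conj-resp-≈ X Z (≈-sym U′.homomorphism))

  base-id : ∀ {X′ XE YE} (cX : U′.F₀ X′ ≡ U.F₀ XE) (cY : U′.F₀ X′ ≡ U.F₀ YE) →
            base (X′ , XE , cX) (X′ , YE , cY) E′.id B.≈ B.cast (≡.trans (≡.sym cX) cY)
  base-id cX cY = begin
    B.cast cY B.∘ (U′.F₁ E′.id B.∘ B.cast (≡.sym cX)) ≈⟨ refl⟩∘⟨ (U′.identity ⟩∘⟨refl) ⟩
    B.cast cY B.∘ (B.id B.∘ B.cast (≡.sym cX))        ≈⟨ refl⟩∘⟨ B.identityˡ ⟩
    B.cast cY B.∘ B.cast (≡.sym cX)                   ≈⟨ ≈-sym (cast-trans (≡.sym cX) cY) ⟩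
    B.cast (≡.trans (≡.sym cX) cY)                    ∎

  comm⇒base : ∀ {X Y} {f′ : proj₁ X E′.⇒ proj₁ Y} {f : proj₁ (proj₂ X) E.⇒ proj₁ (proj₂ Y)} →
              B.cast (proj₂ (proj₂ Y)) B.∘ U′.F₁ f′ B.≈ U.F₁ f B.∘ B.cast (proj₂ (proj₂ X)) →
              U.F₁ f B.≈ base X Y f′
  comm⇒base {_ , _ , cX} p = ≈-trans (transposeʳ cX (≈-sym p)) B.assoc

  base⇒comm : ∀ {X Y} {f′ : proj₁ X E′.⇒ proj₁ Y} {f : proj₁ (proj₂ X) E.⇒ proj₁ (proj₂ Y)} →
              U.F₁ f B.≈ base X Y f′ →
              B.cast (proj₂ (proj₂ Y)) B.∘ U′.F₁ f′ B.≈ U.F₁ f B.∘ B.cast (proj₂ (proj₂ X))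
  base⇒comm {_ , _ , cX} p =
    ≈-sym (≈-trans (p ⟩∘⟨refl) (≈-trans B.assoc (refl⟩∘⟨ cancelʳ (cast-symˡ cX))))

  hom-over : ∀ {X Y} (f : X Pb.⇒ Y) → U.F₁ (hom f) B.≈ base X Y (hom′ f)
  hom-over f = comm⇒base (comm f)

  cartesian-in-pullback : ∀ {X Y} (φ : X Pb.⇒ Y) → IsCartesian U (hom φ) → IsCartesian π φ
  cartesian-in-pullback {X} {Y} φ φ-cartesian {R} ψ g φ′g≈ψ′ =
    pbhom g χ (base⇒comm χ-over) , (E′R.≈-refl , φ′g≈ψ′ , φχ≈ψ) , unique
    where
    lies-over : U.F₁ (hom φ) B.∘ base R X g B.≈ U.F₁ (hom ψ)
    lies-over = begin
      U.F₁ (hom φ) B.∘ base R X g       ≈⟨ hom-over φ ⟩∘⟨refl ⟩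
      base X Y (hom′ φ) B.∘ base R X g  ≈⟨ base-∘ R X Y ⟩
      base R Y (hom′ φ E′.∘ g)          ≈⟨ base-resp-≈ R Y φ′g≈ψ′ ⟩
      base R Y (hom′ ψ)                 ≈⟨ ≈-sym (hom-over ψ) ⟩
      U.F₁ (hom ψ)                      ∎
    lift = φ-cartesian (hom ψ) (base R X g) lies-over
    χ = proj₁ lift
    χ-over = proj₁ (proj₁ (proj₂ lift))
    φχ≈ψ = proj₂ (proj₁ (proj₂ lift))
    unique : ∀ h → (hom′ h E′.≈ g) × ((hom′ φ E′.∘ hom′ h E′.≈ hom′ ψ) × (hom φ E.∘ hom h E.≈ hom ψ)) →
             (hom′ h E′.≈ g) × (hom h E.≈ χ)
    unique h (h′≈g , _ , φh≈ψ) =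
      h′≈g , proj₂ (proj₂ lift) (hom h) (≈-trans (hom-over h) (base-resp-≈ R X h′≈g) , φh≈ψ)

  opcartesian-in-pullback : ∀ {X Y} (φ : X Pb.⇒ Y) → IsOpcartesian U (hom φ) → IsOpcartesian π φ
  opcartesian-in-pullback {X} {Y} φ φ-opcartesian {R} ψ g gφ′≈ψ′ =
    pbhom g χ (base⇒comm χ-over) , (E′R.≈-refl , gφ′≈ψ′ , χφ≈ψ) , unique
    where
    lies-over : base Y R g B.∘ U.F₁ (hom φ) B.≈ U.F₁ (hom ψ)
    lies-over = begin
      base Y R g B.∘ U.F₁ (hom φ)       ≈⟨ refl⟩∘⟨ hom-over φ ⟩
      base Y R g B.∘ base X Y (hom′ φ)  ≈⟨ base-∘ X Y R ⟩
      base X R (g E′.∘ hom′ φ)          ≈⟨ base-resp-≈ X R gφ′≈ψ′ ⟩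
      base X R (hom′ ψ)                 ≈⟨ ≈-sym (hom-over ψ) ⟩
      U.F₁ (hom ψ)                      ∎
    lift = φ-opcartesian (hom ψ) (base Y R g) lies-over
    χ = proj₁ lift
    χ-over = proj₁ (proj₁ (proj₂ lift))
    χφ≈ψ = proj₂ (proj₁ (proj₂ lift))
    unique : ∀ h → (hom′ h E′.≈ g) × ((hom′ h E′.∘ hom′ φ E′.≈ hom′ ψ) × (hom h E.∘ hom φ E.≈ hom ψ)) →
             (hom′ h E′.≈ g) × (hom h E.≈ χ)
    unique h (h′≈g , _ , hφ≈ψ) =
      h′≈g , proj₂ (proj₂ lift) (hom h) (≈-trans (hom-over h) (base-resp-≈ Y R h′≈g) , hφ≈ψ)

  fibration-pullback : IsFibration U → IsFibration π
  fibration-pullback U-fibration {A′} (P′ , PE , c) f′ with U-fibration PE (B.cast c B.∘ U′.F₁ f′)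
  ... | Q , eq , φ , φ-cartesian , φ-over =
    (A′ , Q , ≡.sym eq) , refl , φ̂ , cartesian-in-pullback φ̂ φ-cartesian , E′R.≈-sym E′.identityʳ
    where
    φ̂ : (A′ , Q , ≡.sym eq) Pb.⇒ (P′ , PE , c)
    φ̂ = pbhom f′ φ (≈-sym (≈-trans (φ-over ⟩∘⟨refl) (cancelʳ (cast-symʳ eq))))

  opfibration-pullback : IsOpfibration U → IsOpfibration π
  opfibration-pullback U-opfibration {A′} (P′ , PE , c) f′ with U-opfibration PE (U′.F₁ f′ B.∘ B.cast (≡.sym c))
  ... | Q , eq , φ , φ-opcartesian , φ-over =
    (A′ , Q , ≡.sym eq) , refl , φ̂ , opcartesian-in-pullback φ̂ φ-opcartesian , E′.identityˡ
    where
    φ̂ : (P′ , PE , c) Pb.⇒ (A′ , Q , ≡.sym eq)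
    φ̂ = pbhom f′ φ (base⇒comm (transposeˡ eq φ-over))

  fibreTerminal-pullback : ∀ {P′ PE} (c : U′.F₀ P′ ≡ U.F₀ PE) →
                           IsFibreTerminal U PE → IsFibreTerminal π (P′ , PE , c)
  fibreTerminal-pullback c PE-terminal R@(_ , RE , cR) refl =
    pbhom E′.id t (base⇒comm t-over) , E′R.≈-refl , unique
    where
    T = PE-terminal RE (≡.trans (≡.sym cR) c)
    t = proj₁ T
    t-over : U.F₁ t B.≈ base R _ E′.id
    t-over = ≈-trans (proj₁ (proj₂ T)) (≈-sym (base-id cR c))
    unique : ∀ h → hom′ h E′.≈ E′.id → (hom′ h E′.≈ E′.id) × (hom h E.≈ t)
    unique h h′≈id =
      h′≈id , proj₂ (proj₂ T) (hom h) (≈-trans (hom-over h) (≈-trans (base-resp-≈ R _ h′≈id) (base-id cR c)))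

  fibreTerminal-component : ∀ {P′ PE} (c : U′.F₀ P′ ≡ U.F₀ PE) →
                            IsFibreTerminal π (P′ , PE , c) → IsFibreTerminal U PE
  fibreTerminal-component {P′} {PE} c P-terminal RE eq = hom t , t-over , unique
    where
    r = ≡.trans c (≡.sym eq)
    id-over : base (P′ , RE , r) (P′ , PE , c) E′.id B.≈ B.cast eq
    id-over = ≈-trans (base-id r c) (cast-trans-sym-trans c eq)
    T = P-terminal (P′ , RE , r) refl
    t = proj₁ T
    t-over : U.F₁ (hom t) B.≈ B.cast eq
    t-over = ≈-trans (hom-over t) (≈-trans (base-resp-≈ _ _ (proj₁ (proj₂ T))) id-over)
    unique : ∀ h → U.F₁ h B.≈ B.cast eq → h E.≈ hom t
    unique h h-over =
      proj₂ (proj₂ (proj₂ T) (pbhom E′.id h (base⇒comm (≈-trans h-over (≈-sym id-over)))) E′R.≈-refl)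

module _ {o ℓ e ob ℓb eb} {E : Category o ℓ e} {B : Category ob ℓb eb} {U : Functor E B}
         (U-fibration : IsFibration U)
         (reindex-terminal : ∀ {Q P} (φ : Category._⇒_ E Q P) → IsCartesian U φ →
                             IsFibreTerminal U P → IsFibreTerminal U Q) where
  private
    module E = Category E
    module B = Category B
    module U = Functor U
    module ER = HomReasoning E
  open HomReasoning B

  -- Reindexing P along g yields a fibre-terminal S with a cartesian ψ : S ⇒ P over g, and a
  -- morphism R ⇒ P over g is the same as a vertical morphism R ⇒ S.
  ∃!-over-fibreTerminal : ∀ {P} → IsFibreTerminal U P → ∀ R (g : U.F₀ R B.⇒ U.F₀ P) →
                          E.∃!⇒ {A = R} {B = P} (λ m → U.F₁ m B.≈ g)
  ∃!-over-fibreTerminal {P} P-terminal R g with U-fibration P g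
  ... | S , eqS , ψ , ψ-cartesian , ψ-over = ψ E.∘ v , ψv-over , unique
    where
    V = reindex-terminal ψ ψ-cartesian P-terminal R (≡.sym eqS)
    v = proj₁ V
    ψ-over′ : U.F₁ ψ B.∘ B.cast (≡.sym eqS) B.≈ g
    ψ-over′ = ≈-trans (ψ-over ⟩∘⟨refl) (cancelʳ (cast-symʳ eqS))
    ψv-over : U.F₁ (ψ E.∘ v) B.≈ g
    ψv-over = ≈-trans U.homomorphism (≈-trans (refl⟩∘⟨ proj₁ (proj₂ V)) ψ-over′)
    unique : ∀ h → U.F₁ h B.≈ g → h E.≈ ψ E.∘ v
    unique h h-over = ER.≈-trans (ER.≈-sym ψχ≈h) (ER.refl⟩∘⟨ proj₂ (proj₂ V) χ χ-over)
      where
      C = ψ-cartesian h (B.cast (≡.sym eqS)) (≈-trans ψ-over′ (≈-sym h-over))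
      χ = proj₁ C
      χ-over = proj₁ (proj₁ (proj₂ C))
      ψχ≈h = proj₂ (proj₁ (proj₂ C))

module CCUPullback
    {o ℓ e ob ℓb eb o′ ℓ′ e′}
    {B : Category ob ℓb eb} {E : Category o ℓ e} {E′ : Category o′ ℓ′ e′}
    (U : Functor E B) (U′ : Functor E′ B)
    (U-ccu : IsCCU U) (U′-fibration : IsFibration U′) where
  private
    module B = Category B
    module E = Category E
    module E′ = Category E′
    module U = Functor U
    module U′ = Functor U′
    module ER = HomReasoning E
    module E′R = HomReasoning E′
  open HomReasoning B
  open PullbackProperties U U′
  open IsCCU U-ccu
  private
    module Pb = Category Pb
    module K = Functor K

  reindex-terminal-pullback : ∀ {Q P} (φ : Q Pb.⇒ P) → IsCartesian π φ →
                              IsFibreTerminal π P → IsFibreTerminal π Q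
  reindex-terminal-pullback {Q} {P@(_ , PE , cP)} φ φ-cartesian P-terminal R@(_ , RE , _) refl =
    proj₁ lift , proj₁ (proj₁ (proj₂ lift)) , unique
    where
    M = ∃!-over-fibreTerminal {U = U} fibration reindex-terminal
          (fibreTerminal-component cP P-terminal) RE (base R P (hom′ φ))
    m : R Pb.⇒ P
    m = pbhom (hom′ φ) (proj₁ M) (base⇒comm (proj₁ (proj₂ M)))
    lift = φ-cartesian m E′.id E′.identityʳ
    unique : ∀ h → hom′ h E′.≈ E′.id → (hom′ h E′.≈ hom′ (proj₁ lift)) × (hom h E.≈ hom (proj₁ lift))
    unique h h′≈id = proj₂ (proj₂ lift) h (h′≈id , φ′h′≈φ′ , proj₂ (proj₂ M) (hom φ E.∘ hom h) φh-over)
      where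
      φ′h′≈φ′ : hom′ φ E′.∘ hom′ h E′.≈ hom′ φ
      φ′h′≈φ′ = E′R.≈-trans (E′R.refl⟩∘⟨ h′≈id) E′.identityʳ
      φh-over : U.F₁ (hom φ E.∘ hom h) B.≈ base R P (hom′ φ)
      φh-over = begin
        U.F₁ (hom φ E.∘ hom h)                  ≈⟨ U.homomorphism ⟩
        U.F₁ (hom φ) B.∘ U.F₁ (hom h)           ≈⟨ hom-over φ ⟩∘⟨ hom-over h ⟩
        base Q P (hom′ φ) B.∘ base R Q (hom′ h) ≈⟨ base-∘ R Q P ⟩
        base R P (hom′ φ E′.∘ hom′ h)           ≈⟨ base-resp-≈ R P φ′h′≈φ′ ⟩
        base R P (hom′ φ)                       ∎

  Kπ₀ : E′.Obj → Pb.Obj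
  Kπ₀ X′ = X′ , K.F₀ (U′.F₀ X′) , ≡.sym (K-over (U′.F₀ X′))

  U∘K-over : ∀ X′ Y′ (u : U′.F₀ X′ B.⇒ U′.F₀ Y′) → U.F₁ (K.F₁ u) B.≈ conj (Kπ₀ X′) (Kπ₀ Y′) u
  U∘K-over X′ Y′ u = ≈-trans (K-over-mor u) (refl⟩∘⟨ (refl⟩∘⟨ ≈-sym (cast-sym-sym (K-over (U′.F₀ X′)))))

  Kπ : Functor E′ Pb
  Kπ = record
    { F₀           = Kπ₀
    ; F₁           = λ {X′} {Y′} f′ → pbhom f′ (K.F₁ (U′.F₁ f′)) (base⇒comm (U∘K-over X′ Y′ (U′.F₁ f′)))
    ; identity     = E′R.≈-refl , ER.≈-trans (K.F-resp-≈ U′.identity) K.identity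
    ; homomorphism = E′R.≈-refl , ER.≈-trans (K.F-resp-≈ U′.homomorphism) K.homomorphism
    ; F-resp-≈     = λ p → p , K.F-resp-≈ (U′.F-resp-≈ p)
    }
  private
    module Kπ = Functor Kπ

  G : Functor E B
  G = proj₁ K-rightAdjoint

  private
    module G = Functor G
    K⊣G = proj₂ K-rightAdjoint
  open Adjunction K⊣G using (counit)

  -- The E′-component of the counit of Kπ at (P′ , PE , c) is a cartesian lift of β along U′.
  β : (A : Pb.Obj) → G.F₀ (proj₁ (proj₂ A)) B.⇒ U′.F₀ (proj₁ A)
  β (_ , PE , c) = B.cast (≡.sym c) B.∘ (U.F₁ (counit PE) B.∘ B.cast (≡.sym (K-over (G.F₀ PE))))

  counit∘K-over : ∀ {X′} (A : Pb.Obj) (b : U′.F₀ X′ B.⇒ G.F₀ (proj₁ (proj₂ A))) →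
                  U.F₁ (counit (proj₁ (proj₂ A)) E.∘ K.F₁ b) B.≈ conj (Kπ₀ X′) A (β A B.∘ b)
  counit∘K-over {X′} (_ , PE , c) b = begin
    U.F₁ (ε E.∘ K.F₁ b)                        ≈⟨ U.homomorphism ⟩
    U.F₁ ε B.∘ U.F₁ (K.F₁ b)                   ≈⟨ refl⟩∘⟨ K-over-mor b ⟩
    U.F₁ ε B.∘ (s B.∘ (b B.∘ B.cast KX))       ≈⟨ ≈-trans (≈-sym B.assoc) (≈-sym B.assoc) ⟩
    ((U.F₁ ε B.∘ s) B.∘ b) B.∘ B.cast KX       ≈⟨ ≈-sym (cancelˡ (cast-symʳ c)) ⟩
    B.cast c B.∘ (B.cast (≡.sym c) B.∘ (((U.F₁ ε B.∘ s) B.∘ b) B.∘ B.cast KX))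
      ≈⟨ refl⟩∘⟨ ≈-trans (≈-sym B.assoc) (≈-sym B.assoc ⟩∘⟨refl) ⟩
    B.cast c B.∘ (((B.cast (≡.sym c) B.∘ (U.F₁ ε B.∘ s)) B.∘ b) B.∘ B.cast KX)
      ≈⟨ refl⟩∘⟨ (refl⟩∘⟨ ≈-sym (cast-sym-sym KX)) ⟩
    conj (Kπ₀ X′) (_ , PE , c) (β (_ , PE , c) B.∘ b) ∎
    where
    ε = counit PE
    s = B.cast (≡.sym (K-over (G.F₀ PE)))
    KX = K-over (U′.F₀ X′)

  R₀ : Pb.Obj → E′.Obj
  R₀ A = proj₁ (U′-fibration (proj₁ A) (β A))

  R₀-over : ∀ A → U′.F₀ (R₀ A) ≡ G.F₀ (proj₁ (proj₂ A))
  R₀-over A = proj₁ (proj₂ (U′-fibration (proj₁ A) (β A)))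

  χ : ∀ A → R₀ A E′.⇒ proj₁ A
  χ A = proj₁ (proj₂ (proj₂ (U′-fibration (proj₁ A) (β A))))

  χ-cartesian : ∀ A → IsCartesian U′ (χ A)
  χ-cartesian A = proj₁ (proj₂ (proj₂ (proj₂ (U′-fibration (proj₁ A) (β A)))))

  χ-over : ∀ A → U′.F₁ (χ A) B.≈ β A B.∘ B.cast (R₀-over A)
  χ-over A = proj₂ (proj₂ (proj₂ (proj₂ (U′-fibration (proj₁ A) (β A)))))

  επ : ∀ A → Kπ₀ (R₀ A) Pb.⇒ A
  επ A@(_ , PE , _) = pbhom (χ A) (counit PE E.∘ K.F₁ (B.cast (R₀-over A)))
    (base⇒comm (≈-trans (counit∘K-over A _) (conj-resp-≈ _ A (≈-sym (χ-over A)))))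

  επ-universal : ∀ {X′ A} (f : Kπ₀ X′ Pb.⇒ A) →
                 E′.∃!⇒ {A = X′} {B = R₀ A} (λ g → επ A Pb.∘ Kπ.F₁ g Pb.≈ f)
  επ-universal {X′} {A@(_ , PE , _)} f = g , (χg≈f′ , εKg≈f) , unique
    where
    transpose = counit-universal K⊣G (hom f)
    b = proj₁ transpose
    f′-over : U′.F₁ (hom′ f) B.≈ β A B.∘ b
    f′-over = conj-injective (Kπ₀ X′) A (begin
      base (Kπ₀ X′) A (hom′ f)         ≈⟨ ≈-sym (hom-over f) ⟩
      U.F₁ (hom f)                     ≈⟨ U.F-resp-≈ (ER.≈-sym (proj₁ (proj₂ transpose))) ⟩
      U.F₁ (counit PE E.∘ K.F₁ b)      ≈⟨ counit∘K-over A b ⟩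
      conj (Kπ₀ X′) A (β A B.∘ b)      ∎)
    lifts : U′.F₁ (χ A) B.∘ (B.cast (≡.sym (R₀-over A)) B.∘ b) B.≈ U′.F₁ (hom′ f)
    lifts = ≈-trans (χ-over A ⟩∘⟨refl) (≈-trans (cancelInner (cast-symʳ (R₀-over A))) (≈-sym f′-over))
    C = χ-cartesian A (hom′ f) (B.cast (≡.sym (R₀-over A)) B.∘ b) lifts
    g = proj₁ C
    χg≈f′ = proj₂ (proj₁ (proj₂ C))
    εKg≈f : (counit PE E.∘ K.F₁ (B.cast (R₀-over A))) E.∘ K.F₁ (U′.F₁ g) E.≈ hom f
    εKg≈f = ER.≈-trans E.assoc (ER.≈-trans (ER.refl⟩∘⟨ ER.≈-sym K.homomorphism)
      (ER.≈-trans (ER.refl⟩∘⟨ K.F-resp-≈ cast∘U′g) (proj₁ (proj₂ transpose))))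
      where
      cast∘U′g : B.cast (R₀-over A) B.∘ U′.F₁ g B.≈ b
      cast∘U′g = ≈-trans (refl⟩∘⟨ proj₁ (proj₁ (proj₂ C))) (cancelˡ (cast-symʳ (R₀-over A)))
    unique : ∀ g₂ → (χ A E′.∘ g₂ E′.≈ hom′ f) ×
                    ((counit PE E.∘ K.F₁ (B.cast (R₀-over A))) E.∘ K.F₁ (U′.F₁ g₂) E.≈ hom f) →
             g₂ E′.≈ g
    unique g₂ (χg₂≈f′ , εKg₂≈f) = proj₂ (proj₂ C) g₂ (transposeˡ (R₀-over A) cast∘U′g₂ , χg₂≈f′)
      where
      cast∘U′g₂ : B.cast (R₀-over A) B.∘ U′.F₁ g₂ B.≈ b
      cast∘U′g₂ = proj₂ (proj₂ transpose) _
        (ER.≈-trans (ER.refl⟩∘⟨ K.homomorphism) (ER.≈-trans (ER.≈-sym E.assoc) εKg₂≈f))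

  ccu-pullback : IsCCU π
  ccu-pullback = record
    { fibration        = fibration-pullback fibration
    ; K                = Kπ
    ; K-over           = λ _ → refl
    ; K-terminal       = λ X′ → fibreTerminal-pullback _ (K-terminal (U′.F₀ X′))
    ; K-over-mor       = λ _ → E′R.≈-sym (E′R.≈-trans E′.identityˡ E′.identityʳ)
    ; reindex-terminal = reindex-terminal-pullback
    ; K-rightAdjoint   = RightAdjointFromCounit.rightAdjoint Kπ R₀ επ επ-universal
    }

lemma4p7 : ∀ {o ℓ e ob ℓb eb o′ ℓ′ e′}
    {B : Category ob ℓb eb} {E : Category o ℓ e} {E′ : Category o′ ℓ′ e′}
    (U : Functor E B) (U′ : Functor E′ B) →
    IsLawvere U → IsFibration U′ → IsLawvere (PullbackFunctor U U′)
lemma4p7 U U′ (U-ccu , U-opfibration) U′-fibration =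
  CCUPullback.ccu-pullback U U′ U-ccu U′-fibration ,
  PullbackProperties.opfibration-pullback U U′ U-opfibration
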